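{- Let $\mathcal{B}$ be an interval building set on $[n]$, and define $\mathcal{B}'=\mathcal{B}\cup\{\{n+1\},\{n,n+1\},\{n-1,n,n+1\},\dots,[n+1]\}$. Then $\mathcal{B}'$ is a building set on $[n+1]$ and the extended nested complex $\mathcal{N}^{\square}(\mathcal{B})$ is isomorphic (as a simplicial complex) to the nested complex $\mathcal{N}(\mathcal{B}')$.
   Context: A building set on a finite set $X$ is a collection $\mathcal{B}$ of nonempty subsets of $X$ containing all singletons and such that $I\cup J\in\mathcal{B}$ whenever $I,J\in\mathcal{B}$, $I\cap J\neq\varnothing$; $\mathcal{B}_{\max}$ denotes its inclusion-maximal elements. An interval building set on $[n]$ is a building set all of whose elements are intervals $\{a,a+1,\dots,b\}$. A nested collection is a subset $N\subseteq\mathcal{B}\setminus\mathcal{B}_{\max}$ whose members are pairwise nested or disjoint and such that no union of $k\ge2$ pairwise disjoint members lies in $\mathcal{B}$; the nested complex $\mathcal{N}(\mathcal{B})$ is the simplicial complex on vertex set $\mathcal{B}\setminus\mathcal{B}_{\max}$ whose faces are the nested collections. An extended nested collection is a set $\{I_1,\dots,I_m,x_{i_1},\dots,x_{i_r}\}$ with $I_j\in\mathcal{B}$ (maximal elements allowed) and formal symbols $x_i$ ($i\in X$) such that the $I_j$ are pairwise nested or disjoint, no union of $k\ge2$ pairwise disjoint $I_j$'s lies in $\mathcal{B}$, and no $i_\ell$ lies in any $I_j$; the extended nested complex $\mathcal{N}^{\square}(\mathcal{B})$ is the simplicial complex on vertex set $\mathcal{B}\cup\{x_i:i\in X\}$ whose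 faces are the extended nested collections. -}

module Defs where

open import Data.Nat using (ℕ; zero; suc; _≤ᵇ_; _≤_)
open import Data.Fin using (Fin; toℕ)
open import Data.Fin.Subset using (Subset; ⁅_⁆; _∈_; _∉_; _⊆_; _∩_; _∪_; ⋃; Nonempty; Empty)
open import Data.Vec using (tabulate; _∷ʳ_)
open import Data.Bool using (Bool; true; false; _∧_)
open import Data.List using (List; length; map)
open import Data.List.Relation.Unary.All using (All)
open import Data.List.Relation.Unary.AllPairs using (AllPairs)
open import Data.List.Membership.Propositional using () renaming (_∈_ to _∈ᴸ_)
open import Data.Product using (Σ; _×_; ∃; ∃-syntax)
open import Data.Sum using (_⊎_; inj₁; inj₂)
open import Data.Empty using (⊥)
open import Relation.Nullary using (¬_)
open import Relation.Binary.PropositionalEquality using (_≡_)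
open import Function.Bundles using (_⇔_)

-- Ground set [m] is modelled as Fin m (element i of [m] is Fin index i-1);
-- subsets of [m] are Data.Fin.Subset.Subset m.  A collection of subsets is a predicate.
Collection : ℕ → Set₁
Collection m = Subset m → Set

record IsBuildingSet {m : ℕ} (B : Collection m) : Set where
  field
    nonempty   : ∀ I → B I → Nonempty I
    singletons : ∀ (i : Fin m) → B ⁅ i ⁆
    union      : ∀ I J → B I → B J → Nonempty (I ∩ J) → B (I ∪ J)

IsMax : {m : ℕ} → Collection m → Subset m → Set
IsMax B I = B I × (∀ J → B J → I ⊆ J → J ≡ I)

interval : {m : ℕ} → Fin m → Fin m → Subset m
interval a b = tabulate (λ i → (toℕ a ≤ᵇ toℕ i) ∧ (toℕ i ≤ᵇ toℕ b))

IsInterval : {m : ℕ} → Subset m → Set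
IsInterval {m} I = Σ (Fin m) λ a → Σ (Fin m) λ b → (toℕ a ≤ toℕ b) × (I ≡ interval a b)

record IsIntervalBuildingSet {m : ℕ} (B : Collection m) : Set where
  field
    building  : IsBuildingSet B
    intervals : ∀ I → B I → IsInterval I

Disjoint : {m : ℕ} → Subset m → Subset m → Set
Disjoint I J = Empty (I ∩ J)

NestedOrDisjoint : {m : ℕ} → Subset m → Subset m → Set
NestedOrDisjoint I J = I ⊆ J ⊎ J ⊆ I ⊎ Disjoint I J

PairwiseNestedOrDisjoint : {m : ℕ} → (Subset m → Set) → Set
PairwiseNestedOrDisjoint In = ∀ {I J} → In I → In J → NestedOrDisjoint I J

-- No union of k ≥ 2 pairwise disjoint members lies in B
-- (a list S of pairwise disjoint nonempty sets has distinct entries, so length S = k).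
NoDisjointUnionIn : {m : ℕ} → Collection m → (Subset m → Set) → Set
NoDisjointUnionIn B In =
  ∀ (S : List (Subset _)) → (∀ {I} → I ∈ᴸ S → In I) → 2 ≤ length S →
  AllPairs Disjoint S → ¬ B (⋃ S)

-- Nested collections (faces of the nested complex N(B)); a face is a finite
-- set of vertices, represented by a list (only its set of entries matters).
NestedCollection : {m : ℕ} → Collection m → List (Subset m) → Set
NestedCollection B N =
  All (λ I → B I × ¬ IsMax B I) N ×
  PairwiseNestedOrDisjoint (λ I → I ∈ᴸ N) ×
  NoDisjointUnionIn B (λ I → I ∈ᴸ N)

NestedVertex : {m : ℕ} → Collection m → Subset m → Set
NestedVertex B I = B I × ¬ IsMax B I

-- Vertices of the extended nested complex: inj₁ I for I ∈ B, inj₂ i for the symbol x_i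
ExtVertexCarrier : ℕ → Set
ExtVertexCarrier m = Subset m ⊎ Fin m

ExtVertex : {m : ℕ} → Collection m → ExtVertexCarrier m → Set
ExtVertex B (inj₁ I) = B I
ExtVertex B (inj₂ i) = Data.Unit.⊤
  where import Data.Unit

ExtNestedCollection : {m : ℕ} → Collection m → List (ExtVertexCarrier m) → Set
ExtNestedCollection B N =
  (∀ {I} → inj₁ I ∈ᴸ N → B I) ×
  PairwiseNestedOrDisjoint (λ I → inj₁ I ∈ᴸ N) ×
  NoDisjointUnionIn B (λ I → inj₁ I ∈ᴸ N) ×
  (∀ {i I} → inj₂ i ∈ᴸ N → inj₁ I ∈ᴸ N → i ∉ I)

record SimplicialIso {C₁ C₂ : Set}
    (V₁ : C₁ → Set) (F₁ : List C₁ → Set)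
    (V₂ : C₂ → Set) (F₂ : List C₂ → Set) : Set where
  field
    f      : C₁ → C₂
    g      : C₂ → C₁
    f-vert : ∀ v → V₁ v → V₂ (f v)
    g-vert : ∀ w → V₂ w → V₁ (g w)
    gf     : ∀ v → V₁ v → g (f v) ≡ v
    fg     : ∀ w → V₂ w → f (g w) ≡ w
    faces  : ∀ (L : List C₁) → All V₁ L → (F₁ L ⇔ F₂ (map f L))

embed : {n : ℕ} → Subset n → Subset (suc n)
embed I = I ∷ʳ false

-- {k, ..., n} ⊆ Fin (suc n)  (i.e. {k+1,...,n+1} in 1-indexed notation)
upperInterval : {n : ℕ} → Fin (suc n) → Subset (suc n)
upperInterval k = tabulate (λ i → toℕ k ≤ᵇ toℕ i)

extendBS : {n : ℕ} → Collection n → Collection (suc n)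
extendBS {n} B J = (∃[ I ] (B I × J ≡ embed I)) ⊎ (∃[ k ] (J ≡ upperInterval {n} k))

-- Identify [n] with the first n points of [n+1], keep the sets of B and send x_i to the
-- upper interval {i+1, ..., n+1}; the only maximal element [n+1] of B' is not hit.  Upper
-- intervals form a chain and contain n+1, which no set of B does.  For an interval I = [a, b]
-- of B: if i ∉ I then I and {i+1, ..., n+1} are nested or disjoint; if i ∈ I they are not
-- nested, and when disjoint their union {a, ..., n+1} lies in B'.  So the condition i ∉ I of
-- N□(B) is exactly what N(B') demands of the pair.  If pairwise disjoint images have union
-- {k, ..., n+1}, then n+1 lies in exactly one of them, some {i+1, ..., n+1}, and any other
-- member is a nonempty set of B inside {k, ..., i}; so i is covered by a set of B of the
-- family, which x_i forbids.  Disjoint images whose union is a set of B avoid n+1 and come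
-- from a family in B.
module Submission where

open import Defs
open import Data.Nat using (ℕ; zero; suc; _≤_; _<_; _≤?_; _<?_; z≤n; s≤s; s≤s⁻¹; _≤ᵇ_)
open import Data.Nat.Properties
  using (≤-trans; ≤-total; <⇒≤; <⇒≱; ≰⇒>; ≮⇒≥; <-irrefl; m≤n⇒m≤1+n; ≤⇒≤ᵇ; ≤ᵇ⇒≤)
open import Data.Fin using (Fin; zero; suc; toℕ; inject₁; fromℕ)
open import Data.Fin.Properties using (toℕ-inject₁; toℕ-fromℕ; toℕ<n)
open import Data.Fin.Relation.Unary.Top using (view; ‵fromℕ; ‵inject₁)
open import Data.Fin.Subset
  using (Subset; ⁅_⁆; _∈_; _∉_; _⊆_; _∩_; _∪_; ⋃; Nonempty; ⊥; inside; outside)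
open import Data.Fin.Subset.Properties
  using (∪-comm; ∩-comm; ∪-identityʳ; x∈⁅x⁆; x∈⁅y⁆⇒x≡y; ⊆-antisym; ⊆-reflexive; ∉⊥;
         p⊆p∪q; q⊆p∪q; x∈p∪q⁻; x∈p∪q⁺; x∈p∩q⁻; x∈p∩q⁺; _∈?_)
open import Data.Vec using ([]; _∷_; lookup; tabulate; init; here; there)
open import Data.Vec.Properties
  using (lookup∘tabulate; lookup⇒[]=; []=⇒lookup; ∷ʳ-injectiveˡ; init-∷ʳ; tabulate-cong)
open import Data.Bool using (Bool; true; false; T; _∧_)
open import Data.Bool.Properties using (T-≡; T-∧)
open import Data.Unit using (tt)
open import Data.List using (List; []; _∷_; length; map)
open import Data.List.Properties using (length-map)
open import Data.List.Relation.Unary.All as All using (All)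
import Data.List.Relation.Unary.All.Properties as Allₚ
open import Data.List.Relation.Unary.AllPairs as AllPairs using (AllPairs; _∷_)
import Data.List.Relation.Unary.AllPairs.Properties as AllPairsₚ
open import Data.List.Relation.Unary.Any using (here; there)
open import Data.List.Membership.Propositional using () renaming (_∈_ to _∈ᴸ_)
open import Data.List.Membership.Propositional.Properties using (∈-map⁺; ∈-map⁻)
open import Data.List.Relation.Binary.Subset.Propositional using () renaming (_⊆_ to _⊆ᴸ_)
open import Data.Product using (_×_; ∃-syntax; _,_; proj₁; proj₂)
open import Data.Sum using (inj₁; inj₂; [_,_]′)
import Data.Sum as Sum
import Data.Product as Product
open import Data.Empty using (⊥-elim)
open import Relation.Nullary using (¬_; yes; no)
open import Relation.Binary.PropositionalEquality
open import Function using (_∘_)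
open import Function.Bundles using (mk⇔; Equivalence)

open Equivalence using (to; from)

private
  variable
    m n : ℕ

-- Subsets

∈-tabulate⁺ : ∀ {f : Fin m → Bool} {x} → T (f x) → x ∈ tabulate f
∈-tabulate⁺ {f = f} {x} fx = lookup⇒[]= x (tabulate f) (trans (lookup∘tabulate f x) (to T-≡ fx))

∈-tabulate⁻ : ∀ {f : Fin m → Bool} {x} → x ∈ tabulate f → T (f x)
∈-tabulate⁻ {f = f} {x} x∈ = from T-≡ (trans (sym (lookup∘tabulate f x)) ([]=⇒lookup x∈))

∪-least : ∀ {p q r : Subset m} → p ⊆ r → q ⊆ r → p ∪ q ⊆ r
∪-least {p = p} {q} p⊆r q⊆r x∈ = [ p⊆r , q⊆r ]′ (x∈p∪q⁻ p q x∈)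

q⊆p⇒p∪q≡p : ∀ {p q : Subset m} → q ⊆ p → p ∪ q ≡ p
q⊆p⇒p∪q≡p {q = q} q⊆p = ⊆-antisym (∪-least (λ x∈ → x∈) q⊆p) (p⊆p∪q q)

⊆-⋃ : ∀ {J : Subset m} {S} → J ∈ᴸ S → J ⊆ ⋃ S
⊆-⋃ {S = _ ∷ S} (here refl) = p⊆p∪q (⋃ S)
⊆-⋃ {S = K ∷ S} (there J∈S) = q⊆p∪q K (⋃ S) ∘ ⊆-⋃ J∈S

∈-⋃⁻ : ∀ {x : Fin m} S → x ∈ ⋃ S → ∃[ J ] (J ∈ᴸ S × x ∈ J)
∈-⋃⁻ [] x∈ = ⊥-elim (∉⊥ x∈)
∈-⋃⁻ (K ∷ S) x∈ with x∈p∪q⁻ K (⋃ S) x∈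
... | inj₁ x∈K = K , here refl , x∈K
... | inj₂ x∈⋃S with ∈-⋃⁻ S x∈⋃S
...   | J , J∈S , x∈J = J , there J∈S , x∈J

Disjoint⁺ : ∀ {I J : Subset m} → (∀ {x} → x ∈ I → x ∉ J) → Disjoint I J
Disjoint⁺ {I = I} {J} h (x , x∈I∩J) = let x∈I , x∈J = x∈p∩q⁻ I J x∈I∩J in h x∈I x∈J

Disjoint⁻ : ∀ {I J : Subset m} {x} → Disjoint I J → x ∈ I → x ∉ J
Disjoint⁻ d x∈I x∈J = d (_ , x∈p∩q⁺ (x∈I , x∈J))

Disjoint-sym : ∀ {I J : Subset m} → Disjoint I J → Disjoint J I
Disjoint-sym d = Disjoint⁺ λ x∈J x∈I → Disjoint⁻ d x∈I x∈J

NestedOrDisjoint-sym : ∀ {I J : Subset m} → NestedOrDisjoint I J → NestedOrDisjoint J I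
NestedOrDisjoint-sym (inj₁ I⊆J) = inj₂ (inj₁ I⊆J)
NestedOrDisjoint-sym (inj₂ (inj₁ J⊆I)) = inj₁ J⊆I
NestedOrDisjoint-sym (inj₂ (inj₂ d)) = inj₂ (inj₂ (Disjoint-sym d))

pairwiseDisjoint-∈-unique : ∀ {S : List (Subset m)} {J J′ x} → AllPairs Disjoint S →
  J ∈ᴸ S → J′ ∈ᴸ S → x ∈ J → x ∈ J′ → J ≡ J′
pairwiseDisjoint-∈-unique (_ ∷ _) (here refl) (here refl) _ _ = refl
pairwiseDisjoint-∈-unique (d ∷ _) (here refl) (there J′∈S) x∈J x∈J′ =
  ⊥-elim (Disjoint⁻ (All.lookup d J′∈S) x∈J x∈J′)
pairwiseDisjoint-∈-unique (d ∷ _) (there J∈S) (here refl) x∈J x∈J′ =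
  ⊥-elim (Disjoint⁻ (All.lookup d J∈S) x∈J′ x∈J)
pairwiseDisjoint-∈-unique (_ ∷ ds) (there J∈S) (there J′∈S) = pairwiseDisjoint-∈-unique ds J∈S J′∈S

pairwiseDisjoint-∉-member : ∀ {S : List (Subset m)} → AllPairs Disjoint S → 2 ≤ length S →
  ∀ x → ∃[ J ] (J ∈ᴸ S × x ∉ J)
pairwiseDisjoint-∉-member {S = J₁ ∷ J₂ ∷ _} ((d All.∷ _) ∷ _) (s≤s (s≤s _)) x with x ∈? J₁
... | yes x∈J₁ = J₂ , there (here refl) , Disjoint⁻ d x∈J₁
... | no x∉J₁ = J₁ , here refl , x∉J₁

noDisjointUnion-pair : ∀ {B : Collection m} {P : Subset m → Set} {I J} → NoDisjointUnionIn B P →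
  P I → P J → Disjoint I J → ¬ B (I ∪ J)
noDisjointUnion-pair {B = B} {P} {I} {J} noUnion PI PJ d BI∪J =
  noUnion (I ∷ J ∷ []) members (s≤s (s≤s z≤n)) ((d All.∷ All.[]) ∷ All.[] ∷ AllPairs.[])
    (subst (λ K → B (I ∪ K)) (sym (∪-identityʳ J)) BI∪J)
  where
  members : ∀ {K} → K ∈ᴸ I ∷ J ∷ [] → P K
  members (here refl) = PI
  members (there (here refl)) = PJ

-- Intervals and upper intervals

∈-interval⁺ : ∀ {a b x : Fin m} → toℕ a ≤ toℕ x → toℕ x ≤ toℕ b → x ∈ interval a b
∈-interval⁺ {a = a} {b} a≤x x≤b =
  ∈-tabulate⁺ {f = λ y → (toℕ a ≤ᵇ toℕ y) ∧ (toℕ y ≤ᵇ toℕ b)} (from T-∧ (≤⇒≤ᵇ a≤x , ≤⇒≤ᵇ x≤b))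

∈-interval⁻ : ∀ (a b : Fin m) {x} → x ∈ interval a b → toℕ a ≤ toℕ x × toℕ x ≤ toℕ b
∈-interval⁻ a b x∈ =
  let a≤x , x≤b = to T-∧ (∈-tabulate⁻ {f = λ y → (toℕ a ≤ᵇ toℕ y) ∧ (toℕ y ≤ᵇ toℕ b)} x∈)
  in ≤ᵇ⇒≤ _ _ a≤x , ≤ᵇ⇒≤ _ _ x≤b

∈-upperInterval⁺ : ∀ {k x : Fin (suc n)} → toℕ k ≤ toℕ x → x ∈ upperInterval k
∈-upperInterval⁺ {k = k} k≤x = ∈-tabulate⁺ {f = λ y → toℕ k ≤ᵇ toℕ y} (≤⇒≤ᵇ k≤x)

∈-upperInterval⁻ : ∀ (k : Fin (suc n)) {x} → x ∈ upperInterval k → toℕ k ≤ toℕ x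
∈-upperInterval⁻ k x∈ = ≤ᵇ⇒≤ _ _ (∈-tabulate⁻ {f = λ y → toℕ k ≤ᵇ toℕ y} x∈)

fromℕ∈upperInterval : ∀ (k : Fin (suc n)) → fromℕ n ∈ upperInterval k
fromℕ∈upperInterval {n} k = ∈-upperInterval⁺ (subst (toℕ k ≤_) (sym (toℕ-fromℕ n)) (s≤s⁻¹ (toℕ<n k)))

inject₁∉upperInterval-suc : ∀ (i : Fin n) → inject₁ i ∉ upperInterval (suc i)
inject₁∉upperInterval-suc i x∈ = <-irrefl (sym (toℕ-inject₁ i)) (∈-upperInterval⁻ (suc i) x∈)

upperInterval-anti : ∀ {k k′ : Fin (suc n)} → toℕ k ≤ toℕ k′ → upperInterval k′ ⊆ upperInterval k
upperInterval-anti {k′ = k′} k≤k′ x∈ = ∈-upperInterval⁺ (≤-trans k≤k′ (∈-upperInterval⁻ k′ x∈))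

upperInterval-nestedOrDisjoint : ∀ (k k′ : Fin (suc n)) →
  NestedOrDisjoint (upperInterval k) (upperInterval k′)
upperInterval-nestedOrDisjoint k k′ with ≤-total (toℕ k) (toℕ k′)
... | inj₁ k≤k′ = inj₂ (inj₁ (upperInterval-anti k≤k′))
... | inj₂ k′≤k = inj₁ (upperInterval-anti k′≤k)

upperInterval-∪ : ∀ (k k′ : Fin (suc n)) → ∃[ k″ ] (upperInterval k ∪ upperInterval k′ ≡ upperInterval k″)
upperInterval-∪ k k′ with ≤-total (toℕ k) (toℕ k′)
... | inj₁ k≤k′ = k , q⊆p⇒p∪q≡p (upperInterval-anti k≤k′)
... | inj₂ k′≤k = k′ , trans (∪-comm (upperInterval k) _) (q⊆p⇒p∪q≡p (upperInterval-anti k′≤k))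

zero∉upperInterval-suc : ∀ (i : Fin n) → zero ∉ upperInterval (suc i)
zero∉upperInterval-suc i z∈ with ∈-upperInterval⁻ (suc i) z∈
... | ()

upperInterval-zero-full : ∀ (J : Subset (suc n)) → J ⊆ upperInterval zero
upperInterval-zero-full J _ = ∈-upperInterval⁺ z≤n

⁅fromℕ⁆≡upperInterval-fromℕ : ⁅ fromℕ n ⁆ ≡ upperInterval (fromℕ n)
⁅fromℕ⁆≡upperInterval-fromℕ {n} = ⊆-antisym ⊆U U⊆
  where
  ⊆U : ⁅ fromℕ n ⁆ ⊆ upperInterval (fromℕ n)
  ⊆U x∈ rewrite x∈⁅y⁆⇒x≡y (fromℕ n) x∈ = fromℕ∈upperInterval (fromℕ n)
  U⊆ : upperInterval (fromℕ n) ⊆ ⁅ fromℕ n ⁆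
  U⊆ {x} x∈ with view x
  ... | ‵fromℕ = x∈⁅x⁆ (fromℕ n)
  ... | ‵inject₁ y = ⊥-elim (<⇒≱ (toℕ<n y)
          (subst₂ _≤_ (toℕ-fromℕ n) (toℕ-inject₁ y) (∈-upperInterval⁻ (fromℕ n) x∈)))

-- The embedding of [n] into [n+1]

∈-embed⁺ : ∀ {I : Subset n} {y} → y ∈ I → inject₁ y ∈ embed I
∈-embed⁺ here = here
∈-embed⁺ (there y∈I) = there (∈-embed⁺ y∈I)

∈-embed⁻ : ∀ {I : Subset n} {y} → inject₁ y ∈ embed I → y ∈ I
∈-embed⁻ {I = _ ∷ _} {zero} here = here
∈-embed⁻ {I = _ ∷ _} {suc y} (there y∈I) = there (∈-embed⁻ y∈I)

fromℕ∉embed : ∀ {I : Subset n} → fromℕ n ∉ embed I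
fromℕ∉embed {I = _ ∷ _} (there x∈) = fromℕ∉embed x∈

lookup-embed-fromℕ : ∀ (I : Subset n) → lookup (embed I) (fromℕ n) ≡ false
lookup-embed-fromℕ [] = refl
lookup-embed-fromℕ (_ ∷ I) = lookup-embed-fromℕ I

embed-⊆⁺ : ∀ {I J : Subset n} → I ⊆ J → embed I ⊆ embed J
embed-⊆⁺ I⊆J {x} x∈ with view x
... | ‵fromℕ = ⊥-elim (fromℕ∉embed x∈)
... | ‵inject₁ y = ∈-embed⁺ (I⊆J (∈-embed⁻ x∈))

embed-⊆⁻ : ∀ {I J : Subset n} → embed I ⊆ embed J → I ⊆ J
embed-⊆⁻ I⊆J = ∈-embed⁻ ∘ I⊆J ∘ ∈-embed⁺

embed-Disjoint⁺ : ∀ {I J : Subset n} → Disjoint I J → Disjoint (embed I) (embed J)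
embed-Disjoint⁺ {I = I} {J} d = Disjoint⁺ λ {x} → disjoint-at x
  where
  disjoint-at : ∀ x → x ∈ embed I → x ∉ embed J
  disjoint-at x x∈I x∈J with view x
  ... | ‵fromℕ = fromℕ∉embed x∈I
  ... | ‵inject₁ y = Disjoint⁻ d (∈-embed⁻ x∈I) (∈-embed⁻ x∈J)

embed-Disjoint⁻ : ∀ {I J : Subset n} → Disjoint (embed I) (embed J) → Disjoint I J
embed-Disjoint⁻ d = Disjoint⁺ λ y∈I y∈J → Disjoint⁻ d (∈-embed⁺ y∈I) (∈-embed⁺ y∈J)

embed-nestedOrDisjoint⁺ : ∀ {I J : Subset n} → NestedOrDisjoint I J → NestedOrDisjoint (embed I) (embed J)
embed-nestedOrDisjoint⁺ = Sum.map embed-⊆⁺ (Sum.map embed-⊆⁺ embed-Disjoint⁺)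

embed-nestedOrDisjoint⁻ : ∀ {I J : Subset n} → NestedOrDisjoint (embed I) (embed J) → NestedOrDisjoint I J
embed-nestedOrDisjoint⁻ = Sum.map embed-⊆⁻ (Sum.map embed-⊆⁻ embed-Disjoint⁻)

embed-Nonempty⁻ : ∀ {I : Subset n} → Nonempty (embed I) → Nonempty I
embed-Nonempty⁻ (x , x∈) with view x
... | ‵fromℕ = ⊥-elim (fromℕ∉embed x∈)
... | ‵inject₁ y = y , ∈-embed⁻ x∈

embed-injective : ∀ {I J : Subset n} → embed I ≡ embed J → I ≡ J
embed-injective = ∷ʳ-injectiveˡ _ _

embed-⊥ : embed {n} ⊥ ≡ ⊥
embed-⊥ {zero} = refl
embed-⊥ {suc n} = cong (outside ∷_) embed-⊥

embed-∪ : ∀ (I J : Subset n) → embed (I ∪ J) ≡ embed I ∪ embed J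
embed-∪ [] [] = refl
embed-∪ (_ ∷ I) (_ ∷ J) = cong (_ ∷_) (embed-∪ I J)

embed-∩ : ∀ (I J : Subset n) → embed (I ∩ J) ≡ embed I ∩ embed J
embed-∩ [] [] = refl
embed-∩ (_ ∷ I) (_ ∷ J) = cong (_ ∷_) (embed-∩ I J)

embed-⋃ : ∀ (S : List (Subset n)) → embed (⋃ S) ≡ ⋃ (map embed S)
embed-⋃ [] = embed-⊥
embed-⋃ (I ∷ S) = trans (embed-∪ I (⋃ S)) (cong (embed I ∪_) (embed-⋃ S))

⁅inject₁⁆≡embed⁅⁆ : ∀ (y : Fin n) → ⁅ inject₁ y ⁆ ≡ embed ⁅ y ⁆
⁅inject₁⁆≡embed⁅⁆ zero = cong (inside ∷_) (sym embed-⊥)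
⁅inject₁⁆≡embed⁅⁆ (suc y) = cong (outside ∷_) (⁅inject₁⁆≡embed⁅⁆ y)

∈-embed-interval⁺ : ∀ {a b : Fin n} {x} → toℕ a ≤ toℕ x → toℕ x ≤ toℕ b → x ∈ embed (interval a b)
∈-embed-interval⁺ {n} {b = b} {x} a≤x x≤b with view x
... | ‵fromℕ = ⊥-elim (<⇒≱ (toℕ<n b) (subst (_≤ toℕ b) (toℕ-fromℕ n) x≤b))
... | ‵inject₁ y rewrite toℕ-inject₁ y = ∈-embed⁺ (∈-interval⁺ a≤x x≤b)

∈-embed-interval⁻ : ∀ (a b : Fin n) {x} → x ∈ embed (interval a b) → toℕ a ≤ toℕ x × toℕ x ≤ toℕ b
∈-embed-interval⁻ a b {x} x∈ with view x
... | ‵fromℕ = ⊥-elim (fromℕ∉embed x∈)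
... | ‵inject₁ y rewrite toℕ-inject₁ y = ∈-interval⁻ a b (∈-embed⁻ x∈)

embed-interval-∪-upperInterval : ∀ (a b : Fin n) (k : Fin (suc n)) → toℕ k ≤ suc (toℕ b) →
  ∃[ k′ ] (embed (interval a b) ∪ upperInterval k ≡ upperInterval k′)
embed-interval-∪-upperInterval a b k k≤b+1 with toℕ k ≤? toℕ a
... | yes k≤a = k , trans (∪-comm (embed (interval a b)) (upperInterval k)) (q⊆p⇒p∪q≡p I⊆U)
  where
  I⊆U : embed (interval a b) ⊆ upperInterval k
  I⊆U x∈ = ∈-upperInterval⁺ (≤-trans k≤a (proj₁ (∈-embed-interval⁻ a b x∈)))
... | no k≰a = inject₁ a , ⊆-antisym (∪-least I⊆Uₐ U⊆Uₐ) Uₐ⊆I∪U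
  where
  ∈Uₐ : ∀ {x} → toℕ a ≤ toℕ x → x ∈ upperInterval (inject₁ a)
  ∈Uₐ {x} a≤x = ∈-upperInterval⁺ (subst (_≤ toℕ x) (sym (toℕ-inject₁ a)) a≤x)
  I⊆Uₐ : embed (interval a b) ⊆ upperInterval (inject₁ a)
  I⊆Uₐ x∈ = ∈Uₐ (proj₁ (∈-embed-interval⁻ a b x∈))
  U⊆Uₐ : upperInterval k ⊆ upperInterval (inject₁ a)
  U⊆Uₐ x∈ = ∈Uₐ (≤-trans (<⇒≤ (≰⇒> k≰a)) (∈-upperInterval⁻ k x∈))
  Uₐ⊆I∪U : upperInterval (inject₁ a) ⊆ embed (interval a b) ∪ upperInterval k
  Uₐ⊆I∪U {x} x∈ with toℕ k ≤? toℕ x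
  ... | yes k≤x = x∈p∪q⁺ (inj₂ (∈-upperInterval⁺ k≤x))
  ... | no k≰x = x∈p∪q⁺ (inj₁ (∈-embed-interval⁺ {a = a} {b} a≤x (s≤s⁻¹ (≤-trans (≰⇒> k≰x) k≤b+1))))
    where
    a≤x : toℕ a ≤ toℕ x
    a≤x = subst (_≤ toℕ x) (toℕ-inject₁ a) (∈-upperInterval⁻ (inject₁ a) x∈)

embed-interval-nestedOrDisjoint-upperInterval : ∀ (a b : Fin n) {i} → i ∉ interval a b →
  NestedOrDisjoint (embed (interval a b)) (upperInterval (suc i))
embed-interval-nestedOrDisjoint-upperInterval a b {i} i∉I with toℕ i <? toℕ a
... | yes i<a = inj₁ λ x∈ → ∈-upperInterval⁺ (≤-trans i<a (proj₁ (∈-embed-interval⁻ a b x∈)))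
... | no i≮a = inj₂ (inj₂ (Disjoint⁺ λ x∈I x∈U →
        <⇒≱ (≤-trans (s≤s (proj₂ (∈-embed-interval⁻ a b x∈I))) b<i) (<⇒≤ (∈-upperInterval⁻ (suc i) x∈U))))
  where
  b<i : toℕ b < toℕ i
  b<i = ≰⇒> λ i≤b → i∉I (∈-interval⁺ (≮⇒≥ i≮a) i≤b)

-- The vertex bijection between N□(B) and N(B')

extToNested : ExtVertexCarrier n → Subset (suc n)
extToNested (inj₁ I) = embed I
extToNested (inj₂ i) = upperInterval (suc i)

firstInside : Subset (suc m) → Fin (suc m)
firstInside {zero} _ = zero
firstInside {suc m} (inside ∷ _) = zero
firstInside {suc m} (outside ∷ p) = suc (firstInside p)

decodeVertex : Bool → Fin (suc n) → Subset n → ExtVertexCarrier n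
decodeVertex true (suc i) _ = inj₂ i
decodeVertex _ _ I = inj₁ I

-- A set avoiding n+1 is decoded as a set of B, one containing n+1 as the symbol x_i read
-- off its least element i+1; the maximal element [n+1] of B' decodes to a junk value.
nestedToExt : Subset (suc n) → ExtVertexCarrier n
nestedToExt {n} J = decodeVertex (lookup J (fromℕ n)) (firstInside J) (init J)

upperInterval-suc : ∀ (k : Fin (suc n)) → upperInterval (suc k) ≡ outside ∷ upperInterval k
upperInterval-suc k = cong (outside ∷_) (tabulate-cong λ x → suc≤ᵇsuc (toℕ k) (toℕ x))
  where
  suc≤ᵇsuc : ∀ a b → (suc a ≤ᵇ suc b) ≡ (a ≤ᵇ b)
  suc≤ᵇsuc zero _ = refl
  suc≤ᵇsuc (suc _) _ = refl

firstInside-upperInterval : ∀ (k : Fin (suc n)) → firstInside (upperInterval k) ≡ k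
firstInside-upperInterval {zero} zero = refl
firstInside-upperInterval {suc n} zero = refl
firstInside-upperInterval {suc n} (suc k) =
  trans (cong firstInside (upperInterval-suc k)) (cong suc (firstInside-upperInterval k))

nestedToExt-embed : ∀ (I : Subset n) → nestedToExt (embed I) ≡ inj₁ I
nestedToExt-embed I rewrite lookup-embed-fromℕ I | init-∷ʳ false I = refl

nestedToExt-upperInterval : ∀ (i : Fin n) → nestedToExt (upperInterval (suc i)) ≡ inj₂ i
nestedToExt-upperInterval i
  rewrite []=⇒lookup (fromℕ∈upperInterval (suc i)) | firstInside-upperInterval (suc i) = refl

nestedToExt-extToNested : ∀ v → nestedToExt {n} (extToNested v) ≡ v
nestedToExt-extToNested (inj₁ I) = nestedToExt-embed I
nestedToExt-extToNested (inj₂ i) = nestedToExt-upperInterval i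

image-∉fromℕ : ∀ {L : List (ExtVertexCarrier n)} {J} → J ∈ᴸ map extToNested L → fromℕ n ∉ J →
  ∃[ I ] (inj₁ I ∈ᴸ L × J ≡ embed I)
image-∉fromℕ J∈ top∉J with ∈-map⁻ extToNested J∈
... | inj₁ I , I∈L , refl = I , I∈L , refl
... | inj₂ i , _ , refl = ⊥-elim (top∉J (fromℕ∈upperInterval (suc i)))

image-∈fromℕ : ∀ {L : List (ExtVertexCarrier n)} {J} → J ∈ᴸ map extToNested L → fromℕ n ∈ J →
  ∃[ i ] (inj₂ i ∈ᴸ L × J ≡ upperInterval (suc i))
image-∈fromℕ J∈ top∈J with ∈-map⁻ extToNested J∈
... | inj₁ I , _ , refl = ⊥-elim (fromℕ∉embed top∈J)
... | inj₂ i , xᵢ∈L , refl = i , xᵢ∈L , refl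

embed-preimage : ∀ {L : List (ExtVertexCarrier n)} S → S ⊆ᴸ map extToNested L →
  (∀ {J} → J ∈ᴸ S → fromℕ n ∉ J) → ∃[ S′ ] (map embed S′ ≡ S × (∀ {I} → I ∈ᴸ S′ → inj₁ I ∈ᴸ L))
embed-preimage [] _ _ = [] , refl , λ ()
embed-preimage (J ∷ S) S⊆L top∉S
  with image-∉fromℕ (S⊆L (here refl)) (top∉S (here refl))
     | embed-preimage S (λ J∈S → S⊆L (there J∈S)) (λ J∈S → top∉S (there J∈S))
... | I , I∈L , refl | S′ , refl , S′⊆L =
  I ∷ S′ , refl , λ { (here refl) → I∈L ; (there I′∈S′) → S′⊆L I′∈S′ }

inject₁-uncovered : ∀ {L : List (ExtVertexCarrier n)} →
  (∀ {i I} → inj₂ i ∈ᴸ L → inj₁ I ∈ᴸ L → i ∉ I) →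
  ∀ S → S ⊆ᴸ map extToNested L → AllPairs Disjoint S →
  ∀ {i} → inj₂ i ∈ᴸ L → upperInterval (suc i) ∈ᴸ S → inject₁ i ∉ ⋃ S
inject₁-uncovered {n} avoids S S⊆L disjoint {i} xᵢ∈L Uᵢ∈S i∈⋃S with ∈-⋃⁻ S i∈⋃S
... | J , J∈S , i∈J with fromℕ n ∈? J
...   | yes top∈J = inject₁∉upperInterval-suc i (subst (inject₁ i ∈_) J≡Uᵢ i∈J)
  where
  J≡Uᵢ : J ≡ upperInterval (suc i)
  J≡Uᵢ = pairwiseDisjoint-∈-unique disjoint J∈S Uᵢ∈S top∈J (fromℕ∈upperInterval (suc i))
...   | no top∉J with image-∉fromℕ (S⊆L J∈S) top∉J
...     | I , I∈L , refl = avoids xᵢ∈L I∈L (∈-embed⁻ i∈J)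

module _ {n : ℕ} (B : Collection n) (isIntervalBuildingSet : IsIntervalBuildingSet B) where
  open IsIntervalBuildingSet isIntervalBuildingSet
  open IsBuildingSet building

  embed-∪-upperInterval∈extendBS : ∀ {I} k → B I → Nonempty (embed I ∩ upperInterval k) →
    extendBS B (embed I ∪ upperInterval k)
  embed-∪-upperInterval∈extendBS {I} k BI (x , x∈I∩U) with intervals I BI
  ... | a , b , _ , refl =
    let x∈I , x∈U = x∈p∩q⁻ (embed I) (upperInterval k) x∈I∩U
        k≤b = ≤-trans (∈-upperInterval⁻ k x∈U) (proj₂ (∈-embed-interval⁻ a b x∈I))
    in inj₂ (embed-interval-∪-upperInterval a b k (m≤n⇒m≤1+n k≤b))

  extendBS-isBuildingSet : IsBuildingSet (extendBS B)
  extendBS-isBuildingSet = record { nonempty = nonempty′ ; singletons = singletons′ ; union = union′ }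
    where
    nonempty′ : ∀ J → extendBS B J → Nonempty J
    nonempty′ _ (inj₁ (I , BI , refl)) = Product.map inject₁ ∈-embed⁺ (nonempty I BI)
    nonempty′ _ (inj₂ (k , refl)) = fromℕ n , fromℕ∈upperInterval k
    singletons′ : ∀ x → extendBS B ⁅ x ⁆
    singletons′ x with view x
    ... | ‵inject₁ y = inj₁ (⁅ y ⁆ , singletons y , ⁅inject₁⁆≡embed⁅⁆ y)
    ... | ‵fromℕ = inj₂ (fromℕ n , ⁅fromℕ⁆≡upperInterval-fromℕ)
    union′ : ∀ I J → extendBS B I → extendBS B J → Nonempty (I ∩ J) → extendBS B (I ∪ J)
    union′ _ _ (inj₁ (I , BI , refl)) (inj₁ (J , BJ , refl)) I∩J≠∅ =
      inj₁ (I ∪ J , union I J BI BJ (embed-Nonempty⁻ (subst Nonempty (sym (embed-∩ I J)) I∩J≠∅)) ,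
            sym (embed-∪ I J))
    union′ _ _ (inj₁ (I , BI , refl)) (inj₂ (k , refl)) I∩U≠∅ = embed-∪-upperInterval∈extendBS k BI I∩U≠∅
    union′ _ _ (inj₂ (k , refl)) (inj₁ (I , BI , refl)) U∩I≠∅ =
      subst (extendBS B) (∪-comm (embed I) (upperInterval k))
        (embed-∪-upperInterval∈extendBS k BI (subst Nonempty (∩-comm (upperInterval k) (embed I)) U∩I≠∅))
    union′ _ _ (inj₂ (k , refl)) (inj₂ (k′ , refl)) _ = inj₂ (upperInterval-∪ k k′)

  upperInterval-zero-isMax : IsMax (extendBS B) (upperInterval zero)
  upperInterval-zero-isMax = inj₂ (zero , refl) , λ J _ U⊆J → ⊆-antisym (upperInterval-zero-full J) U⊆J

  ∉⇒¬IsMax : ∀ {J x} → x ∉ J → ¬ IsMax (extendBS B) J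
  ∉⇒¬IsMax {J} x∉J (_ , maximal) =
    x∉J (subst (_ ∈_) (maximal (upperInterval zero) (inj₂ (zero , refl)) (upperInterval-zero-full J))
                      (∈-upperInterval⁺ z≤n))

  extToNested-vertex : ∀ v → ExtVertex B v → NestedVertex (extendBS B) (extToNested v)
  extToNested-vertex (inj₁ I) BI = inj₁ (I , BI , refl) , ∉⇒¬IsMax fromℕ∉embed
  extToNested-vertex (inj₂ i) _ = inj₂ (suc i , refl) , ∉⇒¬IsMax (zero∉upperInterval-suc i)

  nestedVertex⇒image : ∀ {J} → NestedVertex (extendBS B) J → ∃[ v ] (ExtVertex B v × J ≡ extToNested v)
  nestedVertex⇒image (inj₁ (I , BI , refl) , _) = inj₁ I , BI , refl
  nestedVertex⇒image (inj₂ (zero , refl) , ¬max) = ⊥-elim (¬max upperInterval-zero-isMax)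
  nestedVertex⇒image (inj₂ (suc i , refl) , _) = inj₂ i , tt , refl

  nestedToExt-vertex : ∀ J → NestedVertex (extendBS B) J → ExtVertex B (nestedToExt J)
  nestedToExt-vertex _ J-vertex with nestedVertex⇒image J-vertex
  ... | v , v-vertex , refl = subst (ExtVertex B) (sym (nestedToExt-extToNested v)) v-vertex

  extToNested-nestedToExt : ∀ J → NestedVertex (extendBS B) J → extToNested (nestedToExt J) ≡ J
  extToNested-nestedToExt _ J-vertex with nestedVertex⇒image J-vertex
  ... | v , _ , refl = cong extToNested (nestedToExt-extToNested v)

  extToNested-nestedOrDisjoint : ∀ {L} → ExtNestedCollection B L →
    PairwiseNestedOrDisjoint (λ J → J ∈ᴸ map extToNested L)
  extToNested-nestedOrDisjoint {L} (inB , nested , _ , avoids) J∈ J′∈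
    with ∈-map⁻ extToNested J∈ | ∈-map⁻ extToNested J′∈
  ... | v , v∈L , refl | v′ , v′∈L , refl = pair v v′ v∈L v′∈L
    where
    set-vs-symbol : ∀ {I i} → inj₁ I ∈ᴸ L → inj₂ i ∈ᴸ L → NestedOrDisjoint (embed I) (upperInterval (suc i))
    set-vs-symbol {I} I∈L xᵢ∈L with intervals I (inB I∈L)
    ... | a , b , _ , refl = embed-interval-nestedOrDisjoint-upperInterval a b (avoids xᵢ∈L I∈L)
    pair : ∀ v v′ → v ∈ᴸ L → v′ ∈ᴸ L → NestedOrDisjoint (extToNested v) (extToNested v′)
    pair (inj₁ _) (inj₁ _) v∈L v′∈L = embed-nestedOrDisjoint⁺ (nested v∈L v′∈L)
    pair (inj₁ _) (inj₂ _) v∈L v′∈L = set-vs-symbol v∈L v′∈L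
    pair (inj₂ _) (inj₁ _) v∈L v′∈L = NestedOrDisjoint-sym (set-vs-symbol v′∈L v∈L)
    pair (inj₂ i) (inj₂ i′) _ _ = upperInterval-nestedOrDisjoint (suc i) (suc i′)

  upperUnion-reaches-below : ∀ {L} → (∀ {I} → inj₁ I ∈ᴸ L → B I) →
    ∀ S → S ⊆ᴸ map extToNested L → 2 ≤ length S → AllPairs Disjoint S → ∀ k → ⋃ S ≡ upperInterval k →
    ∃[ i ] (inj₂ i ∈ᴸ L × upperInterval (suc i) ∈ᴸ S × inject₁ i ∈ ⋃ S)
  upperUnion-reaches-below inB S S⊆L 2≤|S| disjoint k ⋃S≡U
    with ∈-⋃⁻ S (⊆-reflexive (sym ⋃S≡U) (fromℕ∈upperInterval k))
  ... | J₀ , J₀∈S , top∈J₀ with image-∈fromℕ (S⊆L J₀∈S) top∈J₀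
  ... | i , xᵢ∈L , refl with pairwiseDisjoint-∉-member disjoint 2≤|S| (fromℕ n)
  ... | Z , Z∈S , top∉Z with image-∉fromℕ (S⊆L Z∈S) top∉Z
  ... | I , I∈L , refl with nonempty I (inB I∈L)
  ... | y , y∈I = i , xᵢ∈L , J₀∈S , ⊆-reflexive (sym ⋃S≡U) (∈-upperInterval⁺ (≤-trans k≤y y≤i))
    where
    k≤y : toℕ k ≤ toℕ (inject₁ y)
    k≤y = ∈-upperInterval⁻ k (⊆-reflexive ⋃S≡U (⊆-⋃ Z∈S (∈-embed⁺ y∈I)))
    y≤i : toℕ (inject₁ y) ≤ toℕ (inject₁ i)
    y≤i with toℕ (inject₁ y) ≤? toℕ (inject₁ i)
    ... | yes y≤i = y≤i
    ... | no y≰i = ⊥-elim (fromℕ∉embed (subst (fromℕ n ∈_) (sym Z≡J₀) (fromℕ∈upperInterval (suc i))))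
      where
      y∈Uᵢ : inject₁ y ∈ upperInterval (suc i)
      y∈Uᵢ = ∈-upperInterval⁺ (subst (λ t → suc t ≤ toℕ (inject₁ y)) (toℕ-inject₁ i) (≰⇒> y≰i))
      Z≡J₀ : embed I ≡ upperInterval (suc i)
      Z≡J₀ = pairwiseDisjoint-∈-unique disjoint Z∈S J₀∈S (∈-embed⁺ y∈I) y∈Uᵢ

  extToNested-noDisjointUnion : ∀ {L} → ExtNestedCollection B L →
    NoDisjointUnionIn (extendBS B) (λ J → J ∈ᴸ map extToNested L)
  extToNested-noDisjointUnion (_ , _ , noUnion , _) S S⊆L 2≤|S| disjoint (inj₁ (I , BI , ⋃S≡I))
    with embed-preimage S S⊆L (λ J∈S top∈J → fromℕ∉embed (subst (fromℕ n ∈_) ⋃S≡I (⊆-⋃ J∈S top∈J)))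
  ... | S′ , refl , S′⊆L =
    noUnion S′ S′⊆L (subst (2 ≤_) (length-map embed S′) 2≤|S|)
      (AllPairs.map embed-Disjoint⁻ (AllPairsₚ.map⁻ disjoint))
      (subst B (sym (embed-injective (trans (embed-⋃ S′) ⋃S≡I))) BI)
  extToNested-noDisjointUnion (inB , _ , _ , avoids) S S⊆L 2≤|S| disjoint (inj₂ (k , ⋃S≡U))
    with upperUnion-reaches-below inB S S⊆L 2≤|S| disjoint k ⋃S≡U
  ... | i , xᵢ∈L , Uᵢ∈S , i∈⋃S = inject₁-uncovered avoids S S⊆L disjoint xᵢ∈L Uᵢ∈S i∈⋃S

  extNested⇒nested : ∀ {L} → All (ExtVertex B) L → ExtNestedCollection B L →
    NestedCollection (extendBS B) (map extToNested L)
  extNested⇒nested vertices ext =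
    Allₚ.map⁺ (All.map (λ {v} → extToNested-vertex v) vertices) ,
    extToNested-nestedOrDisjoint ext ,
    extToNested-noDisjointUnion ext

  nested⇒extNested : ∀ {L} → All (ExtVertex B) L → NestedCollection (extendBS B) (map extToNested L) →
    ExtNestedCollection B L
  nested⇒extNested {L} vertices (_ , nested , noUnion) = inB , nested′ , noUnion′ , avoids
    where
    inB : ∀ {I} → inj₁ I ∈ᴸ L → B I
    inB = All.lookup vertices
    nested′ : PairwiseNestedOrDisjoint (λ I → inj₁ I ∈ᴸ L)
    nested′ I∈L J∈L = embed-nestedOrDisjoint⁻ (nested (∈-map⁺ extToNested I∈L) (∈-map⁺ extToNested J∈L))
    noUnion′ : NoDisjointUnionIn B (λ I → inj₁ I ∈ᴸ L)
    noUnion′ S S⊆L 2≤|S| disjoint B⋃S =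
      noUnion (map embed S) embedS⊆L (subst (2 ≤_) (sym (length-map embed S)) 2≤|S|)
        (AllPairsₚ.map⁺ (AllPairs.map embed-Disjoint⁺ disjoint)) (inj₁ (⋃ S , B⋃S , sym (embed-⋃ S)))
      where
      embedS⊆L : map embed S ⊆ᴸ map extToNested L
      embedS⊆L J∈ with ∈-map⁻ embed J∈
      ... | I , I∈S , refl = ∈-map⁺ extToNested (S⊆L I∈S)
    avoids : ∀ {i I} → inj₂ i ∈ᴸ L → inj₁ I ∈ᴸ L → i ∉ I
    avoids {i} {I} xᵢ∈L I∈L i∈I with intervals I (inB I∈L)
    ... | a , b , _ , refl with nested (∈-map⁺ extToNested I∈L) (∈-map⁺ extToNested xᵢ∈L)
    ...   | inj₁ I⊆U = inject₁∉upperInterval-suc i (I⊆U (∈-embed⁺ i∈I))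
    ...   | inj₂ (inj₁ U⊆I) = fromℕ∉embed (U⊆I (fromℕ∈upperInterval (suc i)))
    ...   | inj₂ (inj₂ disjoint) =
      noDisjointUnion-pair {B = extendBS B} {λ J → J ∈ᴸ map extToNested L} noUnion
        (∈-map⁺ extToNested I∈L) (∈-map⁺ extToNested xᵢ∈L) disjoint
        (inj₂ (embed-interval-∪-upperInterval a b (suc i) (s≤s (proj₂ (∈-interval⁻ a b i∈I)))))

  extNested≅nested : SimplicialIso (ExtVertex B) (ExtNestedCollection B)
                                   (NestedVertex (extendBS B)) (NestedCollection (extendBS B))
  extNested≅nested = record
    { f      = extToNested
    ; g      = nestedToExt
    ; f-vert = extToNested-vertex
    ; g-vert = nestedToExt-vertex
    ; gf     = λ v _ → nestedToExt-extToNested v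
    ; fg     = extToNested-nestedToExt
    ; faces  = λ L vertices → mk⇔ (extNested⇒nested vertices) (nested⇒extNested vertices)
    }

theorem4p10 : (n : ℕ) (B : Collection n) → IsIntervalBuildingSet B →
    IsBuildingSet (extendBS B) ×
    SimplicialIso (ExtVertex B) (ExtNestedCollection B)
    (NestedVertex (extendBS B)) (NestedCollection (extendBS B))
theorem4p10 n B isIntervalBuildingSet =
  extendBS-isBuildingSet B isIntervalBuildingSet , extNested≅nested B isIntervalBuildingSet
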